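{- Let $T$ be an $s$-decreasing tree, and let $(a,b)$ and $(c,d)$ be tree ascents of $T$ with $1\le a<b\le n$, $1\le c<d\le n$ and $a<c$. Let $Z$ and $Q$ be the $s$-tree rotations of $T$ along $(a,b)$ and $(c,d)$, respectively. If either $(a,b)$ is not a tree ascent of $Q$ or $(c,d)$ is not a tree ascent of $Z$, then $b=c$ and $s(c)>0$. Moreover, if $(a,b)$ is not a tree ascent of $Q$, then $a\in T^c_0$; and if $(c,d)$ is not a tree ascent of $Z$, then $a\in T^c_{s(c)-1}$.
   Context: $s=(s(1),\dots,s(n))$ is a sequence of nonnegative integers. An $s$-decreasing tree is a planar rooted tree $T$ whose internal vertices are labeled bijectively by $1,\dots,n$ (leaves unlabeled), such that internal vertex $i$ has exactly $s(i)+1$ children indexed $0,\dots,s(i)$ from left to right, and every labeled descendant of $i$ has smaller label. $T^i_j$ is the full subtree rooted at the $j$-th child of $i$. For $x<y$, $\#_T(y,x)$ is: $0$ if $x$ is left of $y$ or $x\in T^y_0$; $i$ if $x\in T^y_i$ with $0<i<s(y)$; $s(y)$ if $x\in T^y_{s(y)}$ or $x$ is right of $y$. $\mathrm{inv}(T)$ is the multiset of pairs $(y,x)$ with multiplicity $\#_T(y,x)$. For such multisets, $I+(b,a)$ increases the multiplicity of $(b,a)$ by one (capped at $s(b)$); $I$ is transitive if for all $a<b<c$ with $\#_I(c,b)=i$, either $\#_I(b,a)=0$ or $\#_I(c,a)\ge i$; $I^{tc}$ is the smallest transitive multiset containing $I$. For $a<b$, $(a,b)$ is a tree ascent of $T$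 if (i) $a\in T^b_i$ for some $0\le i<s(b)$; (ii) whenever $a<e<b$ and $a\in T^e_j$, then $j=s(e)$; (iii) if $s(a)>0$ then $T^a_{s(a)}$ is a leaf. The $s$-tree rotation of $T$ along a tree ascent $(a,b)$ is the unique $s$-decreasing tree $Z$ with $\mathrm{inv}(Z)=(\mathrm{inv}(T)+(b,a))^{tc}$. -}

module Defs where

open import Data.Nat using (ℕ; zero; suc; _≤_; _<_; _⊓_)
open import Data.Nat.Properties using (_≟_)
open import Data.List using (List; []; _∷_; _++_; map; length; upTo)
open import Data.List.Membership.Propositional using (_∈_)
open import Data.List.Relation.Binary.Permutation.Propositional using (_↭_)
open import Data.Product using (Σ; ∃; ∃-syntax; _×_; _,_)
open import Data.Sum using (_⊎_)
open import Relation.Binary.PropositionalEquality using (_≡_)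
open import Relation.Nullary using (¬_; yes; no)

-- Planar rooted trees: leaves are unlabeled, internal vertices carry a
-- natural-number label and an ordered list of children (index 0 = leftmost).

data Tree : Set where
  leaf : Tree
  node : ℕ → List Tree → Tree

mutual
  labels : Tree → List ℕ
  labels leaf        = []
  labels (node i cs) = i ∷ labelsF cs

  labelsF : List Tree → List ℕ
  labelsF []       = []
  labelsF (c ∷ cs) = labels c ++ labelsF cs

data _⊑_ : Tree → Tree → Set where
  here  : ∀ {T} → T ⊑ T
  there : ∀ {S c i cs} → S ⊑ c → c ∈ cs → S ⊑ node i cs

data Nth {A : Set} : List A → ℕ → A → Set where
  nth-zero : ∀ {x xs} → Nth (x ∷ xs) zero x
  nth-suc  : ∀ {y xs j x} → Nth xs j x → Nth (y ∷ xs) (suc j) x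

-- s-decreasing trees, with s given as a function ℕ → ℕ of which only the
-- values s 1, …, s n matter.

record IsSDecTree (s : ℕ → ℕ) (n : ℕ) (T : Tree) : Set where
  field
    bijective  : labels T ↭ map suc (upTo n)
    arity      : ∀ {i cs} → node i cs ⊑ T → length cs ≡ suc (s i)
    decreasing : ∀ {i cs x} → node i cs ⊑ T → x ∈ labelsF cs → x < i

-- Subtree T^y_j : S is the j-th child subtree of vertex y in T.
SubT : Tree → ℕ → ℕ → Tree → Set
SubT T y j S = Σ (List Tree) λ cs → (node y cs ⊑ T) × Nth cs j S

InSub : Tree → ℕ → ℕ → ℕ → Set
InSub T y j x = Σ Tree λ S → SubT T y j S × x ∈ labels S

LeftOf : Tree → ℕ → ℕ → Set
LeftOf T x y = ∃[ z ] ∃[ i ] ∃[ j ] (i < j × InSub T z i x × InSub T z j y)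

-- Count s T y x k  :  #_T(y,x) = k   (for x < y)
Count : (ℕ → ℕ) → Tree → ℕ → ℕ → ℕ → Set
Count s T y x k =
    (k ≡ 0 × (LeftOf T x y ⊎ InSub T y 0 x))
  ⊎ ((0 < k × k < s y) × InSub T y k x)
  ⊎ (k ≡ s y × (InSub T y (s y) x ⊎ LeftOf T y x))

-- Multisets of pairs (y,x) with 1 ≤ x < y ≤ n, given by their
-- multiplicity function M y x (values outside this range are irrelevant).

Multiset : Set
Multiset = ℕ → ℕ → ℕ

InvOf : (ℕ → ℕ) → ℕ → Tree → Multiset → Set
InvOf s n T M = ∀ y x → 1 ≤ x → x < y → y ≤ n → Count s T y x (M y x)

incr : (ℕ → ℕ) → Multiset → ℕ → ℕ → Multiset
incr s M b a y x with y ≟ b | x ≟ a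
... | yes _ | yes _ = suc (M b a) ⊓ s b
... | _     | _     = M y x

_⊆[_]_ : Multiset → ℕ → Multiset → Set
I ⊆[ n ] J = ∀ y x → 1 ≤ x → x < y → y ≤ n → I y x ≤ J y x

Transitive : ℕ → Multiset → Set
Transitive n I = ∀ a b c → 1 ≤ a → a < b → b < c → c ≤ n →
  I b a ≡ 0 ⊎ I c b ≤ I c a

IsTC : ℕ → Multiset → Multiset → Set
IsTC n I J = Transitive n J × I ⊆[ n ] J ×
  (∀ K → Transitive n K → I ⊆[ n ] K → J ⊆[ n ] K)

record TreeAscent (s : ℕ → ℕ) (T : Tree) (a b : ℕ) : Set where
  field
    asc-lt : a < b
    asc-i   : ∃[ i ] (i < s b × InSub T b i a)
    asc-ii  : ∀ e j → a < e → e < b → InSub T e j a → j ≡ s e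
    asc-iii : 0 < s a → ∀ S → SubT T a (s a) S → S ≡ leaf

IsRotation : (ℕ → ℕ) → ℕ → Tree → ℕ → ℕ → Tree → Set
IsRotation s n T a b Z = IsSDecTree s n Z ×
  ∃[ MT ] ∃[ MZ ] (InvOf s n T MT × InvOf s n Z MZ × IsTC n (incr s MT b a) MZ)

-- Everything is read off inversion multisets.  If (u,v) is an ascent of T with u in the i-th child
-- of v, the rotation R along it satisfies  inv T ≤ inv R ≤ inv T ⊔ B  and  #_R(v,u) ≥ i + 1, where B
-- raises #(v,x) to i + 1 for x = u and for the x < u with #_T(u,x) ≥ 1: the right-hand side is
-- already transitive and contains inv T + (v,u).  Hence rotating along (a,b) keeps every #(y,x)
-- with x > a, and rotating along (c,d) only touches pairs (d,x).  Checking the three ascent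
-- conditions against these bounds, (c,d) can only fail in Z when the raise of #(b,·) fills the
-- last child of c, i.e. b = c and a lies in child s(c) − 1; and (a,b) can only fail in Q when a
-- becomes left of b, i.e. b = c and a lies in child 0.

module Submission where

open import Defs
open import Data.Nat using (ℕ; suc; _≤_; _<_; _∸_; _⊔_; _⊓_; z≤n; s≤s; _≟_; _<?_; _≤?_)
open import Data.Nat.Properties
open import Data.Product using (_×_; ∃-syntax; _,_; proj₁; proj₂; map₂)
open import Data.Sum using (_⊎_; inj₁; inj₂; [_,_])
open import Data.Empty using (⊥-elim)
open import Data.List using (List; []; _∷_; _++_; map; length; upTo)
open import Data.List.Membership.Propositional using (_∈_)
open import Data.List.Membership.Propositional.Properties using (∈-++⁺ˡ; ∈-++⁺ʳ; ∈-++⁻; ∈-map⁻; ∈-upTo⁻)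
open import Data.List.Relation.Unary.Any using (here; there)
import Data.List.Relation.Unary.All as All
open import Data.List.Relation.Unary.All.Properties using (++⁻ˡ)
open import Data.List.Relation.Unary.AllPairs using ([]; _∷_)
open import Data.List.Relation.Unary.Unique.Propositional using (Unique)
import Data.List.Relation.Unary.Unique.Propositional.Properties as Unique
open import Data.List.Relation.Binary.Disjoint.Propositional using (Disjoint)
open import Data.List.Relation.Binary.Permutation.Propositional using (_↭_; ↭-sym; ↭⇒↭ₛ)
open import Data.List.Relation.Binary.Permutation.Propositional.Properties using (∈-resp-↭)
import Data.List.Relation.Binary.Permutation.Setoid.Properties as Perm
open import Function using (_∘_)
open import Relation.Binary.Definitions using (tri<; tri≈; tri>)
open import Relation.Binary.PropositionalEquality
  using (_≡_; _≢_; refl; sym; trans; cong; subst; setoid; module ≡-Reasoning)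
open import Relation.Nullary using (¬_; Dec; yes; no)
open import Relation.Nullary.Decidable using (_×-dec_; _⊎-dec_)

m<k≤m⊔n⇒k≤n : ∀ {k m n} → m < k → k ≤ m ⊔ n → k ≤ n
m<k≤m⊔n⇒k≤n {k} {m} {n} m<k k≤m⊔n with ≤-total m n
... | inj₁ m≤n = subst (k ≤_) (m≤n⇒m⊔n≡n m≤n) k≤m⊔n
... | inj₂ n≤m = ⊥-elim (<-irrefl refl (<-≤-trans m<k (subst (k ≤_) (m≥n⇒m⊔n≡m n≤m) k≤m⊔n)))

module _ {A : Set} where

  unique-++ˡ : ∀ xs {ys : List A} → Unique (xs ++ ys) → Unique xs
  unique-++ˡ []       _         = []
  unique-++ˡ (x ∷ xs) (x∉ ∷ u) = ++⁻ˡ xs x∉ ∷ unique-++ˡ xs u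

  unique-++ʳ : ∀ xs {ys : List A} → Unique (xs ++ ys) → Unique ys
  unique-++ʳ []       u       = u
  unique-++ʳ (x ∷ xs) (_ ∷ u) = unique-++ʳ xs u

  unique-++⇒disjoint : ∀ xs {ys : List A} → Unique (xs ++ ys) → Disjoint xs ys
  unique-++⇒disjoint (x ∷ xs) (x∉ ∷ _) (here refl , z∈ys) = All.lookup x∉ (∈-++⁺ʳ xs z∈ys) refl
  unique-++⇒disjoint (x ∷ xs) (_ ∷ u)  (there z∈xs , z∈ys) = unique-++⇒disjoint xs u (z∈xs , z∈ys)

  Nth⇒∈ : ∀ {xs : List A} {j x} → Nth xs j x → x ∈ xs
  Nth⇒∈ nth-zero    = here refl
  Nth⇒∈ (nth-suc p) = there (Nth⇒∈ p)

  Nth⇒<length : ∀ {xs : List A} {j x} → Nth xs j x → j < length xs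
  Nth⇒<length nth-zero    = s≤s z≤n
  Nth⇒<length (nth-suc p) = s≤s (Nth⇒<length p)

∈-labelsF : ∀ {c cs x} → c ∈ cs → x ∈ labels c → x ∈ labelsF cs
∈-labelsF {cs = c ∷ cs} (here refl) x∈c = ∈-++⁺ˡ x∈c
∈-labelsF {cs = c ∷ cs} (there c∈)  x∈c = ∈-++⁺ʳ (labels c) (∈-labelsF c∈ x∈c)

⊑-trans : ∀ {S U X} → S ⊑ U → U ⊑ X → S ⊑ X
⊑-trans S⊑U here           = S⊑U
⊑-trans S⊑U (there U⊑c c∈) = there (⊑-trans S⊑U U⊑c) c∈

∈-labels-⊑ : ∀ {S X x} → S ⊑ X → x ∈ labels S → x ∈ labels X
∈-labels-⊑ here            x∈S = x∈S
∈-labels-⊑ (there S⊑c c∈) x∈S = there (∈-labelsF c∈ (∈-labels-⊑ S⊑c x∈S))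

mutual
  ∈-labels⇒⊑ : ∀ {S x} → x ∈ labels S → ∃[ cs ] node x cs ⊑ S
  ∈-labels⇒⊑ {node i cs} (here refl) = cs , here
  ∈-labels⇒⊑ {node i cs} (there x∈)  with ∈-labelsF⇒⊑ cs x∈
  ... | ds , c , c∈ , x⊑c = ds , there x⊑c c∈

  ∈-labelsF⇒⊑ : ∀ cs {x} → x ∈ labelsF cs → ∃[ ds ] ∃[ c ] (c ∈ cs × node x ds ⊑ c)
  ∈-labelsF⇒⊑ (c ∷ cs) x∈ with ∈-++⁻ (labels c) x∈
  ... | inj₁ x∈c  = let ds , x⊑c = ∈-labels⇒⊑ x∈c in ds , c , here refl , x⊑c
  ... | inj₂ x∈cs = let ds , c′ , c′∈ , x⊑c′ = ∈-labelsF⇒⊑ cs x∈cs in ds , c′ , there c′∈ , x⊑c′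

unique-child : ∀ {c cs} → Unique (labelsF cs) → c ∈ cs → Unique (labels c)
unique-child {cs = c ∷ cs} u (here refl) = unique-++ˡ (labels c) u
unique-child {cs = c ∷ cs} u (there c∈)  = unique-child (unique-++ʳ (labels c) u) c∈

unique-⊑ : ∀ {S X} → Unique (labels X) → S ⊑ X → Unique (labels S)
unique-⊑ u       here           = u
unique-⊑ (_ ∷ u) (there S⊑c c∈) = unique-⊑ (unique-child u c∈) S⊑c

child-unique : ∀ {cs c₁ c₂ x} → Unique (labelsF cs) → c₁ ∈ cs → c₂ ∈ cs →
               x ∈ labels c₁ → x ∈ labels c₂ → c₁ ≡ c₂
child-unique {c ∷ cs} u (here refl) (here refl) _ _ = refl
child-unique {c ∷ cs} u (here refl) (there c₂∈) x₁ x₂ =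
  ⊥-elim (unique-++⇒disjoint (labels c) u (x₁ , ∈-labelsF c₂∈ x₂))
child-unique {c ∷ cs} u (there c₁∈) (here refl) x₁ x₂ =
  ⊥-elim (unique-++⇒disjoint (labels c) u (x₂ , ∈-labelsF c₁∈ x₁))
child-unique {c ∷ cs} u (there c₁∈) (there c₂∈) x₁ x₂ =
  child-unique (unique-++ʳ (labels c) u) c₁∈ c₂∈ x₁ x₂

child-index-unique : ∀ {cs j j′ S S′ x} → Unique (labelsF cs) → Nth cs j S → Nth cs j′ S′ →
                     x ∈ labels S → x ∈ labels S′ → j ≡ j′
child-index-unique {c ∷ cs} u nth-zero    nth-zero     _ _ = refl
child-index-unique {c ∷ cs} u nth-zero    (nth-suc p′) x₁ x₂ =
  ⊥-elim (unique-++⇒disjoint (labels c) u (x₁ , ∈-labelsF (Nth⇒∈ p′) x₂))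
child-index-unique {c ∷ cs} u (nth-suc p) nth-zero     x₁ x₂ =
  ⊥-elim (unique-++⇒disjoint (labels c) u (x₂ , ∈-labelsF (Nth⇒∈ p) x₁))
child-index-unique {c ∷ cs} u (nth-suc p) (nth-suc p′) x₁ x₂ =
  cong suc (child-index-unique (unique-++ʳ (labels c) u) p p′ x₁ x₂)

⊑-node-unique : ∀ {X y cs cs′} → Unique (labels X) → node y cs ⊑ X → node y cs′ ⊑ X → cs ≡ cs′
⊑-node-unique u        here           here           = refl
⊑-node-unique (y∉ ∷ u) here           (there p c∈)   =
  ⊥-elim (All.lookup y∉ (∈-labelsF c∈ (∈-labels-⊑ p (here refl))) refl)
⊑-node-unique (y∉ ∷ u) (there p c∈)   here           =
  ⊥-elim (All.lookup y∉ (∈-labelsF c∈ (∈-labels-⊑ p (here refl))) refl)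
⊑-node-unique (_ ∷ u)  (there p₁ c₁∈) (there p₂ c₂∈)
  with child-unique u c₁∈ c₂∈ (∈-labels-⊑ p₁ (here refl)) (∈-labels-⊑ p₂ (here refl))
... | refl = ⊑-node-unique (unique-child u c₁∈) p₁ p₂

↭-1…n⇒unique : ∀ {xs n} → xs ↭ map suc (upTo n) → Unique xs
↭-1…n⇒unique {n = n} p =
  Perm.Unique-resp-↭ (setoid ℕ) (↭⇒↭ₛ (↭-sym p)) (Unique.map⁺ suc-injective (Unique.upTo⁺ n))

CountView : (ℕ → ℕ) → Tree → ℕ → ℕ → ℕ → Set
CountView s X y x k = (k ≡ 0 × LeftOf X x y) ⊎ InSub X y k x ⊎ (k ≡ s y × LeftOf X y x)

count-view : ∀ s {X y x k} → Count s X y x k → CountView s X y x k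
count-view s (inj₁ (refl , inj₁ x◁y))         = inj₁ (refl , x◁y)
count-view s (inj₁ (refl , inj₂ x∈))          = inj₂ (inj₁ x∈)
count-view s (inj₂ (inj₁ (_ , x∈)))           = inj₂ (inj₁ x∈)
count-view s (inj₂ (inj₂ (refl , inj₁ x∈)))   = inj₂ (inj₁ x∈)
count-view s (inj₂ (inj₂ (refl , inj₂ y◁x))) = inj₂ (inj₂ (refl , y◁x))

leaf-child-empty : ∀ {X y j x} → (∀ S → SubT X y j S → S ≡ leaf) → ¬ InSub X y j x
leaf-child-empty isLeaf (S , S-sub , x∈S) with isLeaf S S-sub
leaf-child-empty isLeaf (.leaf , _ , ()) | refl

SubT⇒⊑ : ∀ {X z j S} → SubT X z j S → S ⊑ X
SubT⇒⊑ (cs , z⊑ , nth) = ⊑-trans (there here (Nth⇒∈ nth)) z⊑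

module SDecTree {s n X M} (isX : IsSDecTree s n X) (invX : InvOf s n X M) where
  open IsSDecTree isX

  labels-unique : Unique (labels X)
  labels-unique = ↭-1…n⇒unique bijective

  label-range : ∀ {x} → x ∈ labels X → 1 ≤ x × x ≤ n
  label-range x∈ with ∈-map⁻ suc (∈-resp-↭ bijective x∈)
  ... | k , k∈ , refl = s≤s z≤n , ∈-upTo⁻ k∈

  -- Comparability of vertices is read off from inv(X) rather than proved from the tree shape.
  inv-view : ∀ {u v} → u ∈ labels X → v ∈ labels X → u < v → CountView s X v u (M v u)
  inv-view u∈ v∈ u<v = count-view s (invX _ _ (proj₁ (label-range u∈)) u<v (proj₂ (label-range v∈)))

  InSub⇒∈ : ∀ {y j x} → InSub X y j x → x ∈ labels X
  InSub⇒∈ (S , S-sub , x∈S) = ∈-labels-⊑ (SubT⇒⊑ S-sub) x∈S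

  InSub⇒root∈ : ∀ {y j x} → InSub X y j x → y ∈ labels X
  InSub⇒root∈ (_ , (_ , y⊑ , _) , _) = ∈-labels-⊑ y⊑ (here refl)

  InSub⇒< : ∀ {y j x} → InSub X y j x → x < y
  InSub⇒< (S , (cs , y⊑ , nth) , x∈S) = decreasing y⊑ (∈-labelsF (Nth⇒∈ nth) x∈S)

  InSub⇒index≤ : ∀ {y j x} → InSub X y j x → j ≤ s y
  InSub⇒index≤ (S , (cs , y⊑ , nth) , _) = ≤-pred (subst (_ <_) (arity y⊑) (Nth⇒<length nth))

  InSub-index-unique : ∀ {y j j′ x} → InSub X y j x → InSub X y j′ x → j ≡ j′
  InSub-index-unique (S , (cs , y⊑ , nth) , x∈) (S′ , (cs′ , y⊑′ , nth′) , x∈′)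
    with ⊑-node-unique labels-unique y⊑ y⊑′
  ... | refl with unique-⊑ labels-unique y⊑
  ...   | _ ∷ u = child-index-unique u nth nth′ x∈ x∈′

  InSub-trans : ∀ {x y i z j} → InSub X y i x → InSub X z j y → InSub X z j x
  InSub-trans (S , (cs , y⊑ , nth) , x∈S) (S′ , z-sub , y∈S′) with ∈-labels⇒⊑ y∈S′
  ... | cs′ , y⊑S′ with ⊑-node-unique labels-unique (⊑-trans y⊑S′ (SubT⇒⊑ z-sub)) y⊑
  ...   | refl = S′ , z-sub , ∈-labels-⊑ y⊑S′ (there (∈-labelsF (Nth⇒∈ nth) x∈S))

  LeftOf-descʳ : ∀ {x y j u} → LeftOf X x y → InSub X y j u → LeftOf X x u
  LeftOf-descʳ (z , p , q , p<q , x∈ , y∈) u∈ = z , p , q , p<q , x∈ , InSub-trans u∈ y∈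

  LeftOf-descˡ : ∀ {x y j u} → LeftOf X y x → InSub X y j u → LeftOf X u x
  LeftOf-descˡ (z , p , q , p<q , y∈ , x∈) u∈ = z , p , q , p<q , InSub-trans u∈ y∈ , x∈

  InSub⇒¬LeftOfʳ : ∀ {y j x} → InSub X y j x → ¬ LeftOf X x y
  InSub⇒¬LeftOfʳ x∈ (z , p , q , p<q , x∈zp , y∈zq) with InSub-index-unique x∈zp (InSub-trans x∈ y∈zq)
  ... | refl = <-irrefl refl p<q

  InSub⇒¬LeftOfˡ : ∀ {y j x} → InSub X y j x → ¬ LeftOf X y x
  InSub⇒¬LeftOfˡ x∈ (z , p , q , p<q , y∈zp , x∈zq) with InSub-index-unique x∈zq (InSub-trans x∈ y∈zp)
  ... | refl = <-irrefl refl p<q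

  InSub-ancestors-nested : ∀ {u p w v r} → InSub X u p w → InSub X v r w → u < v → InSub X v r u
  InSub-ancestors-nested w∈u w∈v u<v with inv-view (InSub⇒root∈ w∈u) (InSub⇒root∈ w∈v) u<v
  ... | inj₁ (_ , u◁v)         = ⊥-elim (InSub⇒¬LeftOfʳ w∈v (LeftOf-descˡ u◁v w∈u))
  ... | inj₂ (inj₂ (_ , v◁u)) = ⊥-elim (InSub⇒¬LeftOfˡ w∈v (LeftOf-descʳ v◁u w∈u))
  ... | inj₂ (inj₁ u∈v) with InSub-index-unique (InSub-trans w∈u u∈v) w∈v
  ...   | refl = u∈v

  LeftOf-asym : ∀ {x y} → LeftOf X x y → ¬ LeftOf X y x
  LeftOf-asym (z₁ , p , q , p<q , x∈₁ , y∈₁) (z₂ , r , t , r<t , y∈₂ , x∈₂) with <-cmp z₁ z₂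
  ... | tri< z₁<z₂ _ _
    with InSub-index-unique (InSub-ancestors-nested x∈₁ x∈₂ z₁<z₂) (InSub-ancestors-nested y∈₁ y∈₂ z₁<z₂)
  ...   | refl = <-irrefl refl r<t
  LeftOf-asym (z₁ , p , q , p<q , x∈₁ , y∈₁) (z₂ , r , t , r<t , y∈₂ , x∈₂) | tri≈ _ refl _
    with InSub-index-unique x∈₁ x∈₂ | InSub-index-unique y∈₁ y∈₂
  ... | refl | refl = <-asym p<q r<t
  LeftOf-asym (z₁ , p , q , p<q , x∈₁ , y∈₁) (z₂ , r , t , r<t , y∈₂ , x∈₂) | tri> _ _ z₂<z₁
    with InSub-index-unique (InSub-ancestors-nested x∈₂ x∈₁ z₂<z₁) (InSub-ancestors-nested y∈₂ y∈₁ z₂<z₁)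
  ... | refl = <-irrefl refl p<q

  LeftOf-acyclic₃ : ∀ {x w y} → LeftOf X x w → LeftOf X w y → ¬ LeftOf X y x
  LeftOf-acyclic₃ (z₁ , p , q , p<q , x∈ , w∈₁) (z₂ , r , t , r<t , w∈₂ , y∈) y◁x with <-cmp z₁ z₂
  ... | tri< z₁<z₂ _ _ =
    LeftOf-asym (z₂ , r , t , r<t , InSub-trans x∈ (InSub-ancestors-nested w∈₁ w∈₂ z₁<z₂) , y∈) y◁x
  ... | tri> _ _ z₂<z₁ =
    LeftOf-asym (z₁ , p , q , p<q , x∈ , InSub-trans y∈ (InSub-ancestors-nested w∈₂ w∈₁ z₂<z₁)) y◁x
  ... | tri≈ _ refl _ with InSub-index-unique w∈₁ w∈₂
  ...   | refl = LeftOf-asym (z₁ , p , t , <-trans p<q r<t , x∈ , y∈) y◁x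

  Count-functional : ∀ {y x k k′} → Count s X y x k → Count s X y x k′ → k ≡ k′
  Count-functional c c′ with count-view s c | count-view s c′
  ... | inj₁ (refl , _)         | inj₁ (refl , _)          = refl
  ... | inj₁ (_ , x◁y)          | inj₂ (inj₁ x∈)           = ⊥-elim (InSub⇒¬LeftOfʳ x∈ x◁y)
  ... | inj₁ (_ , x◁y)          | inj₂ (inj₂ (_ , y◁x))    = ⊥-elim (LeftOf-asym x◁y y◁x)
  ... | inj₂ (inj₁ x∈)          | inj₁ (_ , x◁y)           = ⊥-elim (InSub⇒¬LeftOfʳ x∈ x◁y)
  ... | inj₂ (inj₁ x∈)          | inj₂ (inj₁ x∈′)          = InSub-index-unique x∈ x∈′
  ... | inj₂ (inj₁ x∈)          | inj₂ (inj₂ (_ , y◁x))    = ⊥-elim (InSub⇒¬LeftOfˡ x∈ y◁x)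
  ... | inj₂ (inj₂ (_ , y◁x))   | inj₁ (_ , x◁y)           = ⊥-elim (LeftOf-asym x◁y y◁x)
  ... | inj₂ (inj₂ (_ , y◁x))   | inj₂ (inj₁ x∈)           = ⊥-elim (InSub⇒¬LeftOfˡ x∈ y◁x)
  ... | inj₂ (inj₂ (refl , _))  | inj₂ (inj₂ (refl , _))   = refl

  InSub⇒Count : ∀ {y j x} → InSub X y j x → Count s X y x j
  InSub⇒Count {y} {j} x∈ with j ≟ 0
  ... | yes refl = inj₁ (refl , inj₂ x∈)
  ... | no j≢0 with j ≟ s y
  ...   | yes refl = inj₂ (inj₂ (refl , inj₁ x∈))
  ...   | no j≢s   = inj₂ (inj₁ ((n≢0⇒n>0 j≢0 , ≤∧≢⇒< (InSub⇒index≤ x∈) j≢s) , x∈))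

  LeftOf⇒∈ : ∀ {x y} → LeftOf X x y → x ∈ labels X × y ∈ labels X
  LeftOf⇒∈ (_ , _ , _ , _ , x∈ , y∈) = InSub⇒∈ x∈ , InSub⇒∈ y∈

  CountView⇒∈ : ∀ {y x k} → CountView s X y x k → x ∈ labels X × y ∈ labels X
  CountView⇒∈ (inj₁ (_ , x◁y))        = LeftOf⇒∈ x◁y
  CountView⇒∈ (inj₂ (inj₁ x∈))        = InSub⇒∈ x∈ , InSub⇒root∈ x∈
  CountView⇒∈ (inj₂ (inj₂ (_ , y◁x))) = proj₂ (LeftOf⇒∈ y◁x) , proj₁ (LeftOf⇒∈ y◁x)

  Count⇒inv≡ : ∀ {y x k} → Count s X y x k → x < y → M y x ≡ k
  Count⇒inv≡ c x<y with CountView⇒∈ (count-view s c)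
  ... | x∈ , y∈ = Count-functional (invX _ _ (proj₁ (label-range x∈)) x<y (proj₂ (label-range y∈))) c

  inv-InSub : ∀ {y j x} → InSub X y j x → M y x ≡ j
  inv-InSub x∈ = Count⇒inv≡ (InSub⇒Count x∈) (InSub⇒< x∈)

  inv-LeftOf : ∀ {x y} → LeftOf X x y → x < y → M y x ≡ 0
  inv-LeftOf x◁y = Count⇒inv≡ (inj₁ (refl , inj₁ x◁y))

  inv-RightOf : ∀ {x y} → LeftOf X y x → x < y → M y x ≡ s y
  inv-RightOf y◁x = Count⇒inv≡ (inj₂ (inj₂ (refl , inj₂ y◁x)))

  inv≤s : ∀ {y x} → 1 ≤ x → x < y → y ≤ n → M y x ≤ s y
  inv≤s {y} 1≤x x<y y≤n with count-view s (invX _ _ 1≤x x<y y≤n)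
  ... | inj₁ (e , _)         = subst (_≤ s y) (sym e) z≤n
  ... | inj₂ (inj₁ x∈)       = InSub⇒index≤ x∈
  ... | inj₂ (inj₂ (e , _))  = ≤-reflexive e

  inv-descendant : ∀ {y j x w} → InSub X y j x → y < w → w ≤ n → M w x ≡ M w y
  inv-descendant x∈ y<w w≤n with count-view s (invX _ _ (proj₁ (label-range (InSub⇒root∈ x∈))) y<w w≤n)
  ... | inj₁ (e , y◁w)        = trans (inv-LeftOf (LeftOf-descˡ y◁w x∈) (<-trans (InSub⇒< x∈) y<w)) (sym e)
  ... | inj₂ (inj₁ y∈)        = inv-InSub (InSub-trans x∈ y∈)
  ... | inj₂ (inj₂ (e , w◁y)) = trans (inv-RightOf (LeftOf-descʳ w◁y x∈) (<-trans (InSub⇒< x∈) y<w)) (sym e)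

  Count<s⇒InSub : ∀ {y x k} → Count s X y x k → k < s y → ¬ LeftOf X x y → InSub X y k x
  Count<s⇒InSub c k<s ¬x◁y with count-view s c
  ... | inj₁ (_ , x◁y)         = ⊥-elim (¬x◁y x◁y)
  ... | inj₂ (inj₁ x∈)         = x∈
  ... | inj₂ (inj₂ (refl , _)) = ⊥-elim (<-irrefl refl k<s)

  inv-transitive : Transitive n M
  inv-transitive a b c 1≤a a<b b<c c≤n with count-view s (invX b a 1≤a a<b (<⇒≤ (<-≤-trans b<c c≤n)))
  ... | inj₁ (e , _)          = inj₁ e
  ... | inj₂ (inj₁ a∈b)       = inj₂ (≤-reflexive (sym (inv-descendant a∈b b<c c≤n)))
  ... | inj₂ (inj₂ (_ , b◁a)) =
    inj₂ (cb≤ca (count-view s (invX c b (≤-trans 1≤a (<⇒≤ a<b)) b<c c≤n))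
                (count-view s (invX c a 1≤a (<-trans a<b b<c) c≤n)))
    where
    cb≤ca : CountView s X c b (M c b) → CountView s X c a (M c a) → M c b ≤ M c a
    cb≤ca (inj₁ (e , _))        _                      = subst (_≤ M c a) (sym e) z≤n
    cb≤ca (inj₂ (inj₁ b∈c))     (inj₁ (_ , a◁c))       = ⊥-elim (LeftOf-asym (LeftOf-descʳ a◁c b∈c) b◁a)
    cb≤ca (inj₂ (inj₁ b∈c))     (inj₂ (inj₂ (e , _)))  = subst (M c b ≤_) (sym e) (InSub⇒index≤ b∈c)
    cb≤ca (inj₂ (inj₁ b∈c))     (inj₂ (inj₁ a∈c)) with M c b ≤? M c a
    ... | yes le = le
    ... | no ≰    = ⊥-elim (LeftOf-asym (c , M c a , M c b , ≰⇒> ≰ , a∈c , b∈c) b◁a)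
    cb≤ca (inj₂ (inj₂ (_ , c◁b))) (inj₁ (_ , a◁c))     = ⊥-elim (LeftOf-acyclic₃ a◁c c◁b b◁a)
    cb≤ca (inj₂ (inj₂ (_ , c◁b))) (inj₂ (inj₁ a∈c))    = ⊥-elim (LeftOf-asym (LeftOf-descˡ c◁b a∈c) b◁a)
    cb≤ca (inj₂ (inj₂ (e , _)))   (inj₂ (inj₂ (e′ , _))) = ≤-reflexive (trans e (sym e′))

  ascent-LeftOf⇒index<inv : ∀ {u v i w} → TreeAscent s X u v → InSub X v i u → i < s v →
                            LeftOf X u w → w < v → v ≤ n → i < M v w
  ascent-LeftOf⇒index<inv {u} {v} {i} {w} asc u∈ i<s u◁w w<v v≤n
    with count-view s (invX v w (proj₁ (label-range (proj₂ (LeftOf⇒∈ u◁w)))) w<v v≤n)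
  ... | inj₁ (_ , w◁v)        = ⊥-elim (LeftOf-asym u◁w (LeftOf-descʳ w◁v u∈))
  ... | inj₂ (inj₂ (e , _))   = subst (i <_) (sym e) i<s
  ... | inj₂ (inj₁ w∈) with <-cmp (M v w) i
  ...   | tri< lt _ _  = ⊥-elim (LeftOf-asym u◁w (v , M v w , i , lt , w∈ , u∈))
  ...   | tri> _ _ gt   = gt
  ...   | tri≈ _ refl _ = ⊥-elim (same-child-¬LeftOf u◁w)
    where
    -- Condition (ii) of the ascent forbids u from sitting left of anything in its own child of v.
    same-child-¬LeftOf : ¬ LeftOf X u w
    same-child-¬LeftOf (z , p , q , p<q , u∈z , w∈z) with <-cmp z v
    ... | tri≈ _ refl _ with InSub-index-unique u∈z u∈ | InSub-index-unique w∈z w∈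
    ...   | refl | refl = <-irrefl refl p<q
    same-child-¬LeftOf (z , p , q , p<q , u∈z , w∈z) | tri> _ _ v<z
      with InSub-index-unique (InSub-trans w∈ (InSub-ancestors-nested u∈ u∈z v<z)) w∈z
    ... | refl = <-irrefl refl p<q
    same-child-¬LeftOf (z , p , q , p<q , u∈z , w∈z) | tri< z<v _ _ =
      <-irrefl refl (<-≤-trans p<q (subst (q ≤_) (sym (TreeAscent.asc-ii asc z p (InSub⇒< u∈z) z<v u∈z))
                                                   (InSub⇒index≤ w∈z)))

  ascent-LeftOf-bounded : ∀ {u v i w MR} → TreeAscent s X u v → InSub X v i u → i < s v →
                          w < v → v ≤ n → M ⊆[ n ] MR → MR v w ≤ i → ¬ LeftOf X u w
  ascent-LeftOf-bounded {u} {v} {i} {w} {MR} asc u∈ i<s w<v v≤n M⊆MR vw≤i u◁w = <-irrefl refl (begin-strict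
    i        <⟨ ascent-LeftOf⇒index<inv asc u∈ i<s u◁w w<v v≤n ⟩
    M v w    ≤⟨ M⊆MR v w (proj₁ (label-range (proj₂ (LeftOf⇒∈ u◁w)))) w<v v≤n ⟩
    MR v w   ≤⟨ vw≤i ⟩
    i        ∎)
    where open ≤-Reasoning

  last-leaf⇒inv<s : ∀ {u x} → 0 < s u → (∀ S → SubT X u (s u) S → S ≡ leaf) →
                    1 ≤ x → x < u → u ≤ n → ¬ LeftOf X u x → M u x < s u
  last-leaf⇒inv<s {u} {x} 0<s last-leaf 1≤x x<u u≤n ¬u◁x with count-view s (invX u x 1≤x x<u u≤n)
  ... | inj₁ (e , _)          = subst (_< s u) (sym e) 0<s
  ... | inj₂ (inj₂ (_ , u◁x)) = ⊥-elim (¬u◁x u◁x)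
  ... | inj₂ (inj₁ x∈) with m≤n⇒m<n∨m≡n (InSub⇒index≤ x∈)
  ...   | inj₁ lt = lt
  ...   | inj₂ eq = ⊥-elim (leaf-child-empty last-leaf (subst (λ k → InSub X u k x) eq x∈))

module AscentWitness {s T u v} (asc : TreeAscent s T u v) where

  index : ℕ
  index = proj₁ (TreeAscent.asc-i asc)

  index<s : index < s v
  index<s = proj₁ (proj₂ (TreeAscent.asc-i asc))

  below : InSub T v index u
  below = proj₂ (proj₂ (TreeAscent.asc-i asc))

module RotationBounds {s n T MT} (isT : IsSDecTree s n T) (invT : InvOf s n T MT)
                      {u v i} (u∈v : InSub T v i u) (i<s : i < s v)
                      {MR} (tc : IsTC n (incr s MT v u) MR) where
  open SDecTree isT invT

  v≤n : v ≤ n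
  v≤n = proj₂ (label-range (InSub⇒root∈ u∈v))

  u<v : u < v
  u<v = InSub⇒< u∈v

  MovesWith : ℕ → Set
  MovesWith x = x ≡ u ⊎ (x < u × 1 ≤ MT u x)

  movesWith? : ∀ x → Dec (MovesWith x)
  movesWith? x = (x ≟ u) ⊎-dec ((x <? u) ×-dec (1 ≤? MT u x))

  bump : Multiset
  bump y x with y ≟ v | movesWith? x
  ... | yes _ | yes _ = suc i
  ... | _     | _     = 0

  bump-view : ∀ y x → bump y x ≡ 0 ⊎ (y ≡ v × MovesWith x × bump y x ≡ suc i)
  bump-view y x with y ≟ v | movesWith? x
  ... | yes y≡v | yes mw = inj₂ (y≡v , mw , refl)
  ... | yes _   | no _   = inj₁ refl
  ... | no _    | _      = inj₁ refl

  bump-moves : ∀ {x} → MovesWith x → bump v x ≡ suc i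
  bump-moves {x} mw with v ≟ v | movesWith? x
  ... | yes _ | yes _  = refl
  ... | no v≢v | _     = ⊥-elim (v≢v refl)
  ... | yes _ | no ¬mw = ⊥-elim (¬mw mw)

  bound : Multiset
  bound y x = MT y x ⊔ bump y x

  bound-unbumped : ∀ {y x} → bump y x ≡ 0 → bound y x ≡ MT y x
  bound-unbumped {y} {x} e = trans (cong (MT y x ⊔_) e) (⊔-identityʳ (MT y x))

  moves-with-below : ∀ {a b} → MovesWith b → 1 ≤ a → a < b → MT b a ≢ 0 → MovesWith a
  moves-with-below (inj₁ refl) _ a<u ba≢0 = inj₂ (a<u , n≢0⇒n>0 ba≢0)
  moves-with-below (inj₂ (b<u , 1≤ub)) 1≤a a<b ba≢0
    with inv-transitive _ _ u 1≤a a<b b<u (<⇒≤ (<-≤-trans u<v v≤n))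
  ... | inj₁ ba≡0 = ⊥-elim (ba≢0 ba≡0)
  ... | inj₂ ub≤ua = inj₂ (<-trans a<b b<u , ≤-trans 1≤ub ub≤ua)

  bound-transitive : Transitive n bound
  bound-transitive a b c 1≤a a<b b<c c≤n with bump-view c b
  ... | inj₁ cb≡0 = subst (λ t → bound b a ≡ 0 ⊎ t ≤ bound c a) (sym (bound-unbumped cb≡0))
                      (unbumped (inv-transitive a b c 1≤a a<b b<c c≤n))
    where
    unbumped : MT b a ≡ 0 ⊎ MT c b ≤ MT c a → bound b a ≡ 0 ⊎ MT c b ≤ bound c a
    unbumped (inj₂ le) = inj₂ (≤-trans le (m≤m⊔n _ _))
    unbumped (inj₁ ba≡0) with bump-view b a
    ... | inj₁ e = inj₁ (trans (bound-unbumped e) ba≡0)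
    ... | inj₂ (refl , inj₁ refl , _) = inj₂ (≤-trans (≤-reflexive cv≡cu) (m≤m⊔n _ _))
      where cv≡cu = sym (inv-descendant u∈v b<c c≤n)
    ... | inj₂ (refl , inj₂ (a<u , 1≤ua) , _) with inv-transitive a u c 1≤a a<u (<-trans u<v b<c) c≤n
    ...   | inj₁ ua≡0 = ⊥-elim (<-irrefl (sym ua≡0) 1≤ua)
    ...   | inj₂ le   = inj₂ (≤-trans (≤-reflexive cv≡cu) (≤-trans le (m≤m⊔n _ _)))
      where cv≡cu = sym (inv-descendant u∈v b<c c≤n)
  ... | inj₂ (refl , b-moves , cb≡) with bump-view b a
  ...   | inj₂ (refl , _ , _) = ⊥-elim (<-irrefl refl b<c)
  ...   | inj₁ ba≡0 with MT b a ≟ 0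
  ...     | yes MTba≡0 = inj₁ (trans (bound-unbumped ba≡0) MTba≡0)
  ...     | no MTba≢0 with inv-transitive a b c 1≤a a<b b<c c≤n
  ...       | inj₁ MTba≡0 = ⊥-elim (MTba≢0 MTba≡0)
  ...       | inj₂ le     =
    inj₂ (subst (λ t → MT c b ⊔ t ≤ bound c a) (sym cb≡) (⊔-mono-≤ le (≤-reflexive ca≡)))
    where ca≡ = sym (bump-moves (moves-with-below b-moves 1≤a a<b MTba≢0))

  incr-view : ∀ y x → incr s MT v u y x ≡ MT y x ⊎ (y ≡ v × x ≡ u × incr s MT v u y x ≡ suc (MT v u) ⊓ s v)
  incr-view y x with y ≟ v | x ≟ u
  ... | yes refl | yes refl = inj₂ (refl , refl , refl)
  ... | yes refl | no _     = inj₁ refl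
  ... | no _     | _        = inj₁ refl

  incr⊆bound : incr s MT v u ⊆[ n ] bound
  incr⊆bound y x _ _ _ with incr-view y x
  ... | inj₁ e = subst (_≤ bound y x) (sym e) (m≤m⊔n _ _)
  ... | inj₂ (refl , refl , e) = subst (_≤ bound v u) (sym e) (begin
    suc (MT v u) ⊓ s v ≤⟨ m⊓n≤m _ _ ⟩
    suc (MT v u)       ≡⟨ cong suc (inv-InSub u∈v) ⟩
    suc i              ≡⟨ sym (bump-moves (inj₁ refl)) ⟩
    bump v u           ≤⟨ m≤n⊔m _ _ ⟩
    bound v u          ∎)
    where open ≤-Reasoning

  inv⊆incr : MT ⊆[ n ] incr s MT v u
  inv⊆incr y x 1≤x x<y y≤n with incr-view y x
  ... | inj₁ e = ≤-reflexive (sym e)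
  ... | inj₂ (refl , refl , e) = subst (MT v u ≤_) (sym e) (⊓-glb (n≤1+n _) (inv≤s 1≤x x<y y≤n))

  inv≤rot : MT ⊆[ n ] MR
  inv≤rot y x 1≤x x<y y≤n = ≤-trans (inv⊆incr y x 1≤x x<y y≤n) (proj₁ (proj₂ tc) y x 1≤x x<y y≤n)

  incr-ascent : incr s MT v u v u ≡ suc (MT v u) ⊓ s v
  incr-ascent with v ≟ v | u ≟ u
  ... | yes _  | yes _  = refl
  ... | no v≢v | _      = ⊥-elim (v≢v refl)
  ... | yes _  | no u≢u = ⊥-elim (u≢u refl)

  rot-ascent : suc i ≤ MR v u
  rot-ascent = begin
    suc i               ≡⟨ sym (m≤n⇒m⊓n≡m i<s) ⟩
    suc i ⊓ s v         ≡⟨ cong (λ t → suc t ⊓ s v) (sym (inv-InSub u∈v)) ⟩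
    suc (MT v u) ⊓ s v  ≡⟨ sym incr-ascent ⟩
    incr s MT v u v u   ≤⟨ proj₁ (proj₂ tc) v u (proj₁ (label-range (InSub⇒∈ u∈v))) u<v v≤n ⟩
    MR v u              ∎
    where open ≤-Reasoning

  rot≤bound : MR ⊆[ n ] bound
  rot≤bound = proj₂ (proj₂ tc) bound bound-transitive incr⊆bound

  rot-unbumped : ∀ {y x} → 1 ≤ x → x < y → y ≤ n → bump y x ≡ 0 → MR y x ≡ MT y x
  rot-unbumped {y} {x} 1≤x x<y y≤n e =
    ≤-antisym (subst (MR y x ≤_) (bound-unbumped e) (rot≤bound y x 1≤x x<y y≤n)) (inv≤rot y x 1≤x x<y y≤n)

module RotationAlongLowerAscent {s n T Z MT MZ a b c d}
  (isT : IsSDecTree s n T) (invT : InvOf s n T MT) (isZ : IsSDecTree s n Z) (invZ : InvOf s n Z MZ)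
  (a<c : a < c)
  (ascᵃᵇ : TreeAscent s T a b) (ascᶜᵈ : TreeAscent s T c d) (tcZ : IsTC n (incr s MT b a) MZ) where

  open AscentWitness ascᵃᵇ renaming (index to i₁; index<s to i₁<s; below to a∈b)
  open AscentWitness ascᶜᵈ renaming (index to i₂; index<s to i₂<s; below to c∈d)

  module InT = SDecTree isT invT
  module InZ = SDecTree isZ invZ
  module Rot = RotationBounds isT invT a∈b i₁<s tcZ

  c<d : c < d
  c<d = InT.InSub⇒< c∈d

  d≤n : d ≤ n
  d≤n = proj₂ (InT.label-range (InT.InSub⇒root∈ c∈d))

  1≤c : 1 ≤ c
  1≤c = proj₁ (InT.label-range (InT.InSub⇒∈ c∈d))

  Z-agrees-above-a : ∀ {y x} → a < x → 1 ≤ x → x < y → y ≤ n → MZ y x ≡ MT y x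
  Z-agrees-above-a {y} {x} a<x 1≤x x<y y≤n = Rot.rot-unbumped 1≤x x<y y≤n unbumped
    where
    unbumped : Rot.bump y x ≡ 0
    unbumped with Rot.bump-view y x
    ... | inj₁ e = e
    ... | inj₂ (_ , inj₁ refl , _)       = ⊥-elim (<-irrefl refl a<x)
    ... | inj₂ (_ , inj₂ (x<a , _) , _) = ⊥-elim (<-asym a<x x<a)

  Z-dc : MZ d c ≡ i₂
  Z-dc = trans (Z-agrees-above-a a<c 1≤c c<d d≤n) (InT.inv-InSub c∈d)

  ¬c◁d : ¬ LeftOf Z c d
  ¬c◁d (z , p , q , p<q , c∈z , d∈z) = <-irrefl refl (<-≤-trans p<q (begin
    q       ≡⟨ sym (InZ.inv-InSub d∈z) ⟩
    MZ z d  ≡⟨ Z-agrees-above-a (<-trans a<c c<d) (≤-trans 1≤c (<⇒≤ c<d)) d<z z≤n′ ⟩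
    MT z d  ≡⟨ sym (InT.inv-descendant c∈d d<z z≤n′) ⟩
    MT z c  ≤⟨ Rot.inv≤rot z c 1≤c (<-trans c<d d<z) z≤n′ ⟩
    MZ z c  ≡⟨ InZ.inv-InSub c∈z ⟩
    p       ∎))
    where
    open ≤-Reasoning
    d<z = InZ.InSub⇒< d∈z
    z≤n′ = proj₂ (InZ.label-range (InZ.InSub⇒root∈ d∈z))

  Z-asc-i : ∃[ i ] (i < s d × InSub Z d i c)
  Z-asc-i = i₂ , i₂<s , subst (λ k → InSub Z d k c) Z-dc
              (InZ.Count<s⇒InSub (invZ d c 1≤c c<d d≤n) (subst (_< s d) (sym Z-dc) i₂<s) ¬c◁d)

  Z-asc-ii : ∀ e j → c < e → e < d → InSub Z e j c → j ≡ s e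
  Z-asc-ii e j c<e e<d c∈e = begin
    j       ≡⟨ sym (InZ.inv-InSub c∈e) ⟩
    MZ e c  ≡⟨ Z-agrees-above-a a<c 1≤c c<e e≤n ⟩
    MT e c  ≡⟨ T-ec ⟩
    s e     ∎
    where
    open ≡-Reasoning
    e≤n = <⇒≤ (<-≤-trans e<d d≤n)
    T-ec : MT e c ≡ s e
    T-ec with count-view s (invT e c 1≤c c<e e≤n)
    ... | inj₂ (inj₁ c∈ₜe)      = TreeAscent.asc-ii ascᶜᵈ e _ c<e e<d c∈ₜe
    ... | inj₂ (inj₂ (e≡ , _)) = e≡
    ... | inj₁ (_ , c◁e) = ⊥-elim (InT.ascent-LeftOf-bounded ascᶜᵈ c∈d i₂<s e<d d≤n Rot.inv≤rot
                             (≤-reflexive (trans (sym (InZ.inv-descendant c∈e e<d d≤n)) Z-dc)) c◁e)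

  Exceptional : Set
  Exceptional = b ≡ c × 0 < s c × i₁ ≡ s c ∸ 1

  -- A vertex x in the last child of c in Z has #_T(c,x) < s c, so the rotation raised #(c,x) to
  -- s c; the bump can do that only if c = b and i₁ + 1 = s c.
  Z-asc-iii : ¬ Exceptional → 0 < s c → ∀ S → SubT Z c (s c) S → S ≡ leaf
  Z-asc-iii _   _   leaf          _     = refl
  Z-asc-iii ¬ex 0<s (node x cs) S-sub = ⊥-elim (¬ex exceptional)
    where
    x∈c : InSub Z c (s c) x
    x∈c = node x cs , S-sub , here refl
    x<c = InZ.InSub⇒< x∈c
    1≤x = proj₁ (InZ.label-range (InZ.InSub⇒∈ x∈c))
    c≤n = <⇒≤ (<-≤-trans c<d d≤n)
    T-cx<s : MT c x < s c
    T-cx<s = InT.last-leaf⇒inv<s 0<s (TreeAscent.asc-iii ascᶜᵈ 0<s) 1≤x x<c c≤n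
               (InT.ascent-LeftOf-bounded ascᶜᵈ c∈d i₂<s (<-trans x<c c<d) d≤n Rot.inv≤rot
                  (≤-reflexive (trans (InZ.inv-descendant x∈c c<d d≤n) Z-dc)))
    Z-cx≡s : MZ c x ≡ s c
    Z-cx≡s = InZ.inv-InSub x∈c
    exceptional : Exceptional
    exceptional with Rot.bump-view c x
    ... | inj₁ unbumped =
      ⊥-elim (<-irrefl (trans (sym (Rot.rot-unbumped 1≤x x<c c≤n unbumped)) Z-cx≡s) T-cx<s)
    ... | inj₂ (refl , _ , bumped) = refl , 0<s , sym (cong (_∸ 1) (≤-antisym s≤1+i₁ i₁<s))
      where
      s≤1+i₁ : s c ≤ suc i₁
      s≤1+i₁ = m<k≤m⊔n⇒k≤n T-cx<s (subst (λ t → s c ≤ MT c x ⊔ t) bumped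
                                      (subst (_≤ Rot.bound c x) Z-cx≡s (Rot.rot≤bound c x 1≤x x<c c≤n)))

  ¬ascent⇒exceptional : ¬ TreeAscent s Z c d → b ≡ c × 0 < s c × InSub T c (s c ∸ 1) a
  ¬ascent⇒exceptional ¬asc with (b ≟ c) ×-dec ((0 <? s c) ×-dec (i₁ ≟ s c ∸ 1))
  ... | yes (refl , 0<s , refl) = refl , 0<s , a∈b
  ... | no ¬ex = ⊥-elim (¬asc record
    { asc-lt = c<d ; asc-i = Z-asc-i ; asc-ii = Z-asc-ii ; asc-iii = Z-asc-iii ¬ex })

module RotationAlongUpperAscent {s n T Q MT MQ a b c d}
  (isT : IsSDecTree s n T) (invT : InvOf s n T MT) (isQ : IsSDecTree s n Q) (invQ : InvOf s n Q MQ)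
  (a<c : a < c)
  (ascᵃᵇ : TreeAscent s T a b) (ascᶜᵈ : TreeAscent s T c d) (tcQ : IsTC n (incr s MT d c) MQ) where

  open AscentWitness ascᵃᵇ renaming (index to i₁; index<s to i₁<s; below to a∈b)
  open AscentWitness ascᶜᵈ renaming (index to i₂; index<s to i₂<s; below to c∈d)

  module InT = SDecTree isT invT
  module InQ = SDecTree isQ invQ
  module Rot = RotationBounds isT invT c∈d i₂<s tcQ

  a<b : a < b
  a<b = InT.InSub⇒< a∈b

  b≤n : b ≤ n
  b≤n = proj₂ (InT.label-range (InT.InSub⇒root∈ a∈b))

  1≤a : 1 ≤ a
  1≤a = proj₁ (InT.label-range (InT.InSub⇒∈ a∈b))

  c<d : c < d
  c<d = InT.InSub⇒< c∈d

  d≤n : d ≤ n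
  d≤n = proj₂ (InT.label-range (InT.InSub⇒root∈ c∈d))

  c≤n : c ≤ n
  c≤n = <⇒≤ (<-≤-trans c<d d≤n)

  -- If b = d, the pair (d,a) is raised only when #_T(c,a) ≥ 1; as a < c < b this puts a right of c,
  -- where #_T(d,a) > i₂ already.
  Q-ba≤T-ba : MQ b a ≤ MT b a
  Q-ba≤T-ba with Rot.bump-view b a
  ... | inj₁ unbumped = ≤-reflexive (Rot.rot-unbumped 1≤a a<b b≤n unbumped)
  ... | inj₂ (_ , inj₁ refl , _) = ⊥-elim (<-irrefl refl a<c)
  ... | inj₂ (refl , inj₂ (_ , 1≤ca) , bumped) = begin
    MQ d a                 ≤⟨ Rot.rot≤bound d a 1≤a a<b b≤n ⟩
    MT d a ⊔ Rot.bump d a  ≡⟨ cong (MT d a ⊔_) bumped ⟩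
    MT d a ⊔ suc i₂        ≡⟨ m≥n⇒m⊔n≡m i₂<T-da ⟩
    MT d a                 ∎
    where
    open ≤-Reasoning
    i₂<T-da : i₂ < MT d a
    i₂<T-da with count-view s (invT c a 1≤a a<c c≤n)
    ... | inj₁ (ca≡0 , _)       = ⊥-elim (<-irrefl (sym ca≡0) 1≤ca)
    ... | inj₂ (inj₂ (_ , c◁a)) = InT.ascent-LeftOf⇒index<inv ascᶜᵈ c∈d i₂<s c◁a (<-trans a<c c<d) d≤n
    ... | inj₂ (inj₁ a∈c) = ⊥-elim (leaf-child-empty (TreeAscent.asc-iii ascᶜᵈ (subst (0 <_) k≡s 1≤ca))
                                                     (subst (λ k → InSub T c k a) k≡s a∈c))
      where
      k≡s = TreeAscent.asc-ii ascᵃᵇ c _ a<c c<d a∈c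

  Q-ba : MQ b a ≡ i₁
  Q-ba = trans (≤-antisym Q-ba≤T-ba (Rot.inv≤rot b a 1≤a a<b b≤n)) (InT.inv-InSub a∈b)

  Exceptional : Set
  Exceptional = b ≡ c × i₁ ≡ 0

  ¬a◁b : ¬ Exceptional → ¬ LeftOf Q a b
  ¬a◁b ¬ex (z , p , q , p<q , a∈z , b∈z) = <-irrefl refl (<-≤-trans p<q (begin
    q       ≡⟨ sym (InQ.inv-InSub b∈z) ⟩
    MQ z b  ≤⟨ Q-zb≤Q-za ⟩
    MQ z a  ≡⟨ InQ.inv-InSub a∈z ⟩
    p       ∎))
    where
    open ≤-Reasoning
    b<z = InQ.InSub⇒< b∈z
    z≤n′ = proj₂ (InQ.label-range (InQ.InSub⇒root∈ b∈z))
    1≤b = ≤-trans 1≤a (<⇒≤ a<b)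
    i₁≡0 : i₁ ≡ 0
    i₁≡0 = trans (sym Q-ba) (InQ.inv-LeftOf (z , p , q , p<q , a∈z , b∈z) a<b)
    T-zb≤Q-za : MT z b ≤ MQ z a
    T-zb≤Q-za = subst (_≤ MQ z a) (InT.inv-descendant a∈b b<z z≤n′)
                      (Rot.inv≤rot z a 1≤a (<-trans a<b b<z) z≤n′)
    Q-zb≤Q-za : MQ z b ≤ MQ z a
    Q-zb≤Q-za with Rot.bump-view z b
    ... | inj₁ unbumped = subst (_≤ MQ z a) (sym (Rot.rot-unbumped 1≤b b<z z≤n′ unbumped)) T-zb≤Q-za
    ... | inj₂ (_ , inj₁ b≡c , _) = ⊥-elim (¬ex (b≡c , i₁≡0))
    ... | inj₂ (refl , inj₂ (b<c , 1≤cb) , bumped) =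
      ≤-trans (subst (λ t → MQ d b ≤ MT d b ⊔ t) bumped (Rot.rot≤bound d b 1≤b b<z z≤n′))
              (⊔-lub T-zb≤Q-za i₂<Q-da)
      where
      1≤Q-ca : 1 ≤ MQ c a
      1≤Q-ca = ≤-trans 1≤cb (subst (_≤ MQ c a) (InT.inv-descendant a∈b b<c c≤n)
                                 (Rot.inv≤rot c a 1≤a (<-trans a<b b<c) c≤n))
      i₂<Q-da : suc i₂ ≤ MQ d a
      i₂<Q-da with proj₁ tcQ a c d 1≤a a<c c<d d≤n
      ... | inj₁ ca≡0 = ⊥-elim (<-irrefl (sym ca≡0) 1≤Q-ca)
      ... | inj₂ le   = ≤-trans Rot.rot-ascent le

  Q-asc-i : ¬ Exceptional → ∃[ i ] (i < s b × InSub Q b i a)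
  Q-asc-i ¬ex = i₁ , i₁<s , subst (λ k → InSub Q b k a) Q-ba
    (InQ.Count<s⇒InSub (invQ b a 1≤a a<b b≤n) (subst (_< s b) (sym Q-ba) i₁<s) (¬a◁b ¬ex))

  Q-asc-ii : ∀ e j → a < e → e < b → InSub Q e j a → j ≡ s e
  Q-asc-ii e j a<e e<b a∈e = trans (sym (InQ.inv-InSub a∈e)) (≤-antisym (InQ.inv≤s 1≤a a<e e≤n) s≤Q-ea)
    where
    e≤n = <⇒≤ (<-≤-trans e<b b≤n)
    T-ea : MT e a ≡ s e
    T-ea with count-view s (invT e a 1≤a a<e e≤n)
    ... | inj₂ (inj₁ a∈ₜe)      = TreeAscent.asc-ii ascᵃᵇ e _ a<e e<b a∈ₜe
    ... | inj₂ (inj₂ (e≡ , _)) = e≡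
    ... | inj₁ (_ , a◁e) = ⊥-elim (InT.ascent-LeftOf-bounded ascᵃᵇ a∈b i₁<s e<b b≤n Rot.inv≤rot
                             (≤-reflexive (trans (sym (InQ.inv-descendant a∈e e<b b≤n)) Q-ba)) a◁e)
    s≤Q-ea : s e ≤ MQ e a
    s≤Q-ea = subst (_≤ MQ e a) T-ea (Rot.inv≤rot e a 1≤a a<e e≤n)

  Q-asc-iii : 0 < s a → ∀ S → SubT Q a (s a) S → S ≡ leaf
  Q-asc-iii _   leaf        _     = refl
  Q-asc-iii 0<s (node x cs) S-sub = ⊥-elim (<-irrefl T-ax≡s T-ax<s)
    where
    x∈a : InSub Q a (s a) x
    x∈a = node x cs , S-sub , here refl
    x<a = InQ.InSub⇒< x∈a
    1≤x = proj₁ (InQ.label-range (InQ.InSub⇒∈ x∈a))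
    a≤n = <⇒≤ (<-≤-trans a<b b≤n)
    unbumped : Rot.bump a x ≡ 0
    unbumped with Rot.bump-view a x
    ... | inj₁ e = e
    ... | inj₂ (a≡d , _) = ⊥-elim (<-irrefl a≡d (<-trans a<c c<d))
    T-ax≡s : MT a x ≡ s a
    T-ax≡s = trans (sym (Rot.rot-unbumped 1≤x x<a a≤n unbumped)) (InQ.inv-InSub x∈a)
    T-ax<s : MT a x < s a
    T-ax<s = InT.last-leaf⇒inv<s 0<s (TreeAscent.asc-iii ascᵃᵇ 0<s) 1≤x x<a a≤n
               (InT.ascent-LeftOf-bounded ascᵃᵇ a∈b i₁<s (<-trans x<a a<b) b≤n Rot.inv≤rot
                  (≤-reflexive (trans (InQ.inv-descendant x∈a a<b b≤n) Q-ba)))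

  ¬ascent⇒exceptional : ¬ TreeAscent s Q a b → b ≡ c × 0 < s c × InSub T c 0 a
  ¬ascent⇒exceptional ¬asc with (b ≟ c) ×-dec (i₁ ≟ 0)
  ... | yes (refl , i₁≡0) = refl , subst (_< s b) i₁≡0 i₁<s , subst (λ k → InSub T b k a) i₁≡0 a∈b
  ... | no ¬ex = ⊥-elim (¬asc record
    { asc-lt = a<b ; asc-i = Q-asc-i ¬ex ; asc-ii = Q-asc-ii ; asc-iii = Q-asc-iii })

lemma3p12 : (n : ℕ) (s : ℕ → ℕ) (T Z Q : Tree) (a b c d : ℕ) →
    IsSDecTree s n T →
    1 ≤ a → a < b → b ≤ n → 1 ≤ c → c < d → d ≤ n → a < c →
    TreeAscent s T a b → TreeAscent s T c d →
    IsRotation s n T a b Z → IsRotation s n T c d Q →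
    ((¬ TreeAscent s Q a b ⊎ ¬ TreeAscent s Z c d) → (b ≡ c × 0 < s c))
    × (¬ TreeAscent s Q a b → InSub T c 0 a)
    × (¬ TreeAscent s Z c d → InSub T c (s c ∸ 1) a)
lemma3p12 n s T Z Q a b c d isT _ _ _ _ _ _ a<c ascᵃᵇ ascᶜᵈ
          (isZ , _ , _ , invT , invZ , tcZ) (isQ , _ , _ , invT′ , invQ , tcQ) =
  [ map₂ proj₁ ∘ viaQ , map₂ proj₁ ∘ viaZ ] , proj₂ ∘ proj₂ ∘ viaQ , proj₂ ∘ proj₂ ∘ viaZ
  where
  viaZ : ¬ TreeAscent s Z c d → b ≡ c × 0 < s c × InSub T c (s c ∸ 1) a
  viaZ = RotationAlongLowerAscent.¬ascent⇒exceptional isT invT isZ invZ a<c ascᵃᵇ ascᶜᵈ tcZ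
  viaQ : ¬ TreeAscent s Q a b → b ≡ c × 0 < s c × InSub T c 0 a
  viaQ = RotationAlongUpperAscent.¬ascent⇒exceptional isT invT′ isQ invQ a<c ascᵃᵇ ascᶜᵈ tcQ
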